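{- Let $v,w$ be words over $[\pm n]$. Then $v\sim w$ if and only if $v^\star\sim w^\star$.
   Context: $[\pm n]=\{1,\dots,n,\overline n,\dots,\overline 1\}$ ($\overline i=-i$, $\overline{\overline i}=i$), ordered $1<\dots<n<\overline n<\dots<\overline 1$. For a word $w=w_1\cdots w_k$, $w^\star=\overline{w_k}\cdots\overline{w_1}$. A column is a strictly increasing word; it is admissible if whenever $i,\overline i$ both occur, with $i$ at position $a$ from the beginning and $\overline i$ at position $b$ from the end, $a+b\le i$. Knuth equivalence $\sim$ is the congruence on the free monoid over $[\pm n]$ generated by (applied to factors): (K1) $\gamma\beta\alpha\sim\beta\gamma\alpha$ if $\gamma<\alpha\le\beta$ and $(\beta,\gamma)\ne(\overline x,x)$ for all $x\in[n]$; (K2) $\alpha\beta\gamma\sim\alpha\gamma\beta$ if $\gamma\le\alpha<\beta$ and $(\beta,\gamma)\ne(\overline x,x)$; (K3) $(y+1)\,\overline{y+1}\,\beta\sim\overline y\,y\,\beta$ if $y<\beta<\overline y$, $y\in[n-1]$; (K4) $\beta\,\overline y\,y\sim\beta\,(y+1)\,\overline{y+1}$ if $y<\beta<\overline y$, $y\in[n-1]$; (K5) $u\sim u\setminus\{z,\overline z\}$ if $u$ is a strictly increasing word that is not an admissible column, every proper factor of $u$ is an admissible column, and $z$ is the least $z\in[n]$ such that $z,\overline z\in u$ and $u$ has more than $z$ letters of absolute value $\le z$. -}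

module Defs where

open import Data.Nat using (ℕ; zero; suc; _+_; _∸_; _≤_; _<_; _>_; _≤?_)
open import Data.Fin using (Fin; toℕ)
import Data.Fin as Fin
open import Data.List using (List; []; _∷_; _++_; length; map; reverse; filter; lookup)
open import Data.List.Membership.Propositional using (_∈_)
open import Data.List.Relation.Unary.Linked using (Linked)
open import Data.Product using (Σ; _×_; ∃; ∃-syntax; _,_)
open import Data.Sum using (_⊎_)
open import Relation.Nullary using (¬_; Dec; yes; no)
open import Relation.Binary.PropositionalEquality using (_≡_)

-- Letters of [±n]:  pos i  is the letter (toℕ i + 1),  neg i  is its bar.
data Letter (n : ℕ) : Set where
  pos : Fin n → Letter n
  neg : Fin n → Letter n

Word : ℕ → Set
Word n = List (Letter n)

bar : ∀ {n} → Letter n → Letter n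
bar (pos i) = neg i
bar (neg i) = pos i

_⋆ : ∀ {n} → Word n → Word n
w ⋆ = reverse (map bar w)

absv : ∀ {n} → Letter n → ℕ
absv (pos i) = suc (toℕ i)
absv (neg i) = suc (toℕ i)

data _<L_ {n : ℕ} : Letter n → Letter n → Set where
  pp : ∀ {i j} → toℕ i < toℕ j → pos i <L pos j
  pn : ∀ {i j} → pos i <L neg j
  nn : ∀ {i j} → toℕ j < toℕ i → neg i <L neg j

_≤L_ : ∀ {n} → Letter n → Letter n → Set
a ≤L b = a ≡ b ⊎ a <L b

BarPair : ∀ {n} → Letter n → Letter n → Set
BarPair {n} β γ = ∃[ x ] (β ≡ neg x × γ ≡ pos x)

StrictlyIncreasing : ∀ {n} → Word n → Set
StrictlyIncreasing = Linked _<L_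

-- admissible column: strictly increasing, and whenever i occurs at position a
-- (1-based, from the beginning) and ī at position b (1-based, from the end),
-- a + b ≤ i.
AdmissibleColumn : ∀ {n} → Word n → Set
AdmissibleColumn {n} u =
  StrictlyIncreasing u ×
  (∀ (p q : Fin (length u)) (k : Fin n) →
     lookup u p ≡ pos k → lookup u q ≡ neg k →
     suc (toℕ p) + (length u ∸ toℕ q) ≤ suc (toℕ k))

ProperFactorsAdmissible : ∀ {n} → Word n → Set
ProperFactorsAdmissible {n} u =
  ∀ (x f y : Word n) → x ++ f ++ y ≡ u → length f < length u → AdmissibleColumn f

countLe : ∀ {n} → ℕ → Word n → ℕ
countLe m u = length (filter (λ a → absv a ≤? m) u)

K5Cond : ∀ {n} → Word n → Fin n → Set
K5Cond u z = pos z ∈ u × neg z ∈ u × countLe (suc (toℕ z)) u > suc (toℕ z)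

LeastK5 : ∀ {n} → Word n → Fin n → Set
LeastK5 {n} u z = K5Cond u z × (∀ (z' : Fin n) → toℕ z' < toℕ z → ¬ K5Cond u z')

removeZ : ∀ {n} → Fin n → Word n → Word n
removeZ z [] = []
removeZ z (pos i ∷ u) with toℕ i Data.Nat.≟ toℕ z
... | yes _ = removeZ z u
... | no _ = pos i ∷ removeZ z u
removeZ z (neg i ∷ u) with toℕ i Data.Nat.≟ toℕ z
... | yes _ = removeZ z u
... | no _ = neg i ∷ removeZ z u

data Elem {n : ℕ} : Word n → Word n → Set where
  K1 : ∀ {α β γ} → γ <L α → α ≤L β → ¬ BarPair β γ →
       Elem (γ ∷ β ∷ α ∷ []) (β ∷ γ ∷ α ∷ [])
  K2 : ∀ {α β γ} → γ ≤L α → α <L β → ¬ BarPair β γ →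
       Elem (α ∷ β ∷ γ ∷ []) (α ∷ γ ∷ β ∷ [])
  -- y = pos i, y+1 = pos j with toℕ j = toℕ i + 1 (so y ∈ [n-1])
  K3 : ∀ {i j : Fin n} {β} → toℕ j ≡ suc (toℕ i) →
       pos i <L β → β <L neg i →
       Elem (pos j ∷ neg j ∷ β ∷ []) (neg i ∷ pos i ∷ β ∷ [])
  K4 : ∀ {i j : Fin n} {β} → toℕ j ≡ suc (toℕ i) →
       pos i <L β → β <L neg i →
       Elem (β ∷ neg i ∷ pos i ∷ []) (β ∷ pos j ∷ neg j ∷ [])
  K5 : ∀ {u z} → StrictlyIncreasing u → ¬ AdmissibleColumn u →
       ProperFactorsAdmissible u → LeastK5 u z →
       Elem u (removeZ z u)

data _∼_ {n : ℕ} : Word n → Word n → Set where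
  step  : ∀ {x l r y} → Elem l r → (x ++ l ++ y) ∼ (x ++ r ++ y)
  refl∼ : ∀ {u} → u ∼ u
  sym∼  : ∀ {u v} → u ∼ v → v ∼ u
  trans∼ : ∀ {u v w} → u ∼ v → v ∼ w → u ∼ w

-- w ↦ w⋆ is an involutive anti-automorphism of the free monoid which reverses
-- the order on [±n].  It carries each defining relation to a defining relation
-- read backwards: (K1) and (K2) are exchanged, as are (K3) and (K4), while an
-- instance of (K5) goes to an instance of (K5), because ⋆ preserves strict
-- increase, admissibility (positions from the beginning and from the end swap
-- roles), membership of z and z̄ and the letter counts, and commutes with
-- deleting z and z̄.  Hence ⋆ preserves ∼, and by involutivity also reflects it.
module Submission where

open import Defs
open import Data.Nat using (ℕ; suc; _+_; _∸_; _≤_; _<_; _>_; _≤?_; _≟_)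
open import Data.Nat.Properties using (+-comm; m+n∸m≡n)
open import Data.Fin using (Fin; toℕ)
import Data.Fin as Fin
open import Data.List using (List; []; _∷_; _++_; length; map; reverse; lookup; _ʳ++_; [_])
open import Data.List.Properties
  using (map-++; reverse-++; reverse-map; reverse-involutive; length-++; length-map;
         length-reverse; ++-assoc; ++-identityʳ)
open import Data.List.Membership.Propositional using (_∈_)
open import Data.List.Membership.Propositional.Properties using (∈-map⁺)
open import Data.List.Relation.Unary.Any.Properties using (reverse⁺)
open import Data.List.Relation.Unary.Linked using (Linked; []; [-]; _∷_)
import Data.List.Relation.Unary.Linked as Linked
import Data.List.Relation.Unary.Linked.Properties as Linked
open import Data.List.Relation.Binary.Permutation.Propositional.Properties using (↭-length; ↭-reverse; filter-↭)
open import Data.Product using (Σ; _×_; _,_; proj₁)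
open import Data.Sum using (inj₁; inj₂)
open import Data.Bool using (true; false)
open import Function using (flip)
open import Function.Bundles using (_⇔_; mk⇔)
open import Level using (Level)
open import Relation.Binary.Core using (Rel)
open import Relation.Nullary using (¬_; yes; no; does)
open import Relation.Binary.PropositionalEquality
  using (_≡_; refl; sym; trans; cong; cong₂; subst; subst₂; module ≡-Reasoning)

module _ {a ℓ : Level} {A : Set a} {R : Rel A ℓ} where

  Linked-ʳ++⁺ : ∀ {x xs acc} → Linked R (x ∷ xs) → Linked (flip R) (x ∷ acc) →
                Linked (flip R) (xs ʳ++ x ∷ acc)
  Linked-ʳ++⁺ {xs = []}     _          racc = racc
  Linked-ʳ++⁺ {xs = _ ∷ _} (rxy ∷ rxs) racc = Linked-ʳ++⁺ rxs (rxy ∷ racc)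

  Linked-reverse⁺ : ∀ {xs} → Linked R xs → Linked (flip R) (reverse xs)
  Linked-reverse⁺ []      = []
  Linked-reverse⁺ [-]     = [-]
  Linked-reverse⁺ r@(_ ∷ _) = Linked-ʳ++⁺ r [-]

module _ {n : ℕ} where

  bar-involutive : (a : Letter n) → bar (bar a) ≡ a
  bar-involutive (pos i) = refl
  bar-involutive (neg i) = refl

  bar-reverses-< : {a b : Letter n} → a <L b → bar b <L bar a
  bar-reverses-< (pp i<j) = nn i<j
  bar-reverses-< pn       = pn
  bar-reverses-< (nn j<i) = pp j<i

  bar-reverses-≤ : {a b : Letter n} → a ≤L b → bar b ≤L bar a
  bar-reverses-≤ (inj₁ refl) = inj₁ refl
  bar-reverses-≤ (inj₂ a<b)  = inj₂ (bar-reverses-< a<b)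

  absv-bar : (a : Letter n) → absv (bar a) ≡ absv a
  absv-bar (pos i) = refl
  absv-bar (neg i) = refl

  ¬BarPair-bar : {β γ : Letter n} → ¬ BarPair β γ → ¬ BarPair (bar γ) (bar β)
  ¬BarPair-bar {neg _} {pos _} ¬bp (x , refl , refl) = ¬bp (x , refl , refl)
  ¬BarPair-bar {pos _} {pos _} ¬bp (_ , _ , ())
  ¬BarPair-bar {pos _} {neg _} ¬bp (_ , () , _)
  ¬BarPair-bar {neg _} {neg _} ¬bp (_ , () , _)

  ⋆-involutive : (w : Word n) → (w ⋆) ⋆ ≡ w
  ⋆-involutive w = begin
    reverse (map bar (reverse (map bar w))) ≡⟨ cong reverse (reverse-map bar (map bar w)) ⟩
    reverse (reverse (map bar (map bar w))) ≡⟨ reverse-involutive (map bar (map bar w)) ⟩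
    map bar (map bar w)                     ≡⟨ map-bar-bar w ⟩
    w                                       ∎
    where
    open ≡-Reasoning
    map-bar-bar : (u : Word n) → map bar (map bar u) ≡ u
    map-bar-bar []      = refl
    map-bar-bar (a ∷ u) = cong₂ _∷_ (bar-involutive a) (map-bar-bar u)

  ⋆-++ : (x y : Word n) → (x ++ y) ⋆ ≡ (y ⋆) ++ (x ⋆)
  ⋆-++ x y = trans (cong reverse (map-++ bar x y)) (reverse-++ (map bar x) (map bar y))

  ⋆-++-++ : (x l y : Word n) → (x ++ l ++ y) ⋆ ≡ (y ⋆) ++ (l ⋆) ++ (x ⋆)
  ⋆-++-++ x l y = begin
    (x ++ l ++ y) ⋆          ≡⟨ ⋆-++ x (l ++ y) ⟩
    ((l ++ y) ⋆) ++ (x ⋆)    ≡⟨ cong (_++ (x ⋆)) (⋆-++ l y) ⟩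
    ((y ⋆) ++ (l ⋆)) ++ x ⋆  ≡⟨ ++-assoc (y ⋆) (l ⋆) (x ⋆) ⟩
    (y ⋆) ++ (l ⋆) ++ (x ⋆)  ∎
    where open ≡-Reasoning

  length-⋆ : (w : Word n) → length (w ⋆) ≡ length w
  length-⋆ w = trans (length-reverse (map bar w)) (length-map bar w)

  ⋆-split : {x y u : Word n} {a : Letter n} → x ++ a ∷ y ≡ u ⋆ → (y ⋆) ++ bar a ∷ (x ⋆) ≡ u
  ⋆-split {x} {y} {u} {a} x·a·y≡u⋆ = begin
    (y ⋆) ++ ([ bar a ] ++ (x ⋆)) ≡⟨ cong ((y ⋆) ++_) (⋆-++ x [ a ]) ⟨
    (y ⋆) ++ ((x ++ [ a ]) ⋆)     ≡⟨ ⋆-++ (x ++ [ a ]) y ⟨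
    ((x ++ [ a ]) ++ y) ⋆         ≡⟨ cong _⋆ (trans (++-assoc x [ a ] y) x·a·y≡u⋆) ⟩
    (u ⋆) ⋆                       ≡⟨ ⋆-involutive u ⟩
    u                             ∎
    where open ≡-Reasoning

  ∈-⋆ : {a : Letter n} {u : Word n} → a ∈ u → bar a ∈ (u ⋆)
  ∈-⋆ a∈u = reverse⁺ (∈-map⁺ bar a∈u)

  StrictlyIncreasing-⋆ : {u : Word n} → StrictlyIncreasing u → StrictlyIncreasing (u ⋆)
  StrictlyIncreasing-⋆ inc =
    Linked-reverse⁺ (Linked.map⁺ (Linked.map bar-reverses-< inc))

  -- Admissibility restated through factorisations u = x · i · y = z · ī · w:
  -- the position of i from the beginning is 1 + |x|, that of ī from the end is 1 + |w|.
  AdmissibleFactorisations : Word n → Set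
  AdmissibleFactorisations u =
    ∀ (k : Fin n) (x y z w : Word n) → x ++ pos k ∷ y ≡ u → z ++ neg k ∷ w ≡ u →
    suc (length x) + suc (length w) ≤ suc (toℕ k)

  index-of-factorisation : (x : Word n) {a : Letter n} {y u : Word n} → x ++ a ∷ y ≡ u →
                           Σ (Fin (length u)) λ p → lookup u p ≡ a × toℕ p ≡ length x
  index-of-factorisation []      refl = Fin.zero , refl , refl
  index-of-factorisation (_ ∷ x) refl with index-of-factorisation x refl
  ... | p , u[p]≡a , p≡|x| = Fin.suc p , u[p]≡a , cong suc p≡|x|

  factorisation-at : (u : Word n) (p : Fin (length u)) →
                     Σ (Word n) λ x → Σ (Word n) λ y → (x ++ lookup u p ∷ y ≡ u) × length x ≡ toℕ p
  factorisation-at (a ∷ u) Fin.zero    = [] , u , refl , refl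
  factorisation-at (a ∷ u) (Fin.suc p) with factorisation-at u p
  ... | x , y , x·b·y≡u , |x|≡p = a ∷ x , y , cong (a ∷_) x·b·y≡u , cong suc |x|≡p

  length-suffix : (z : Word n) {a : Letter n} {w u : Word n} → z ++ a ∷ w ≡ u →
                  length u ∸ length z ≡ suc (length w)
  length-suffix z {w = w} refl =
    trans (cong (_∸ length z) (length-++ z)) (m+n∸m≡n (length z) (suc (length w)))

  admissible⇒factorisations : (u : Word n) → AdmissibleColumn u → AdmissibleFactorisations u
  admissible⇒factorisations u (_ , adm) k x y z w x·k·y≡u z·k̄·w≡u
    with index-of-factorisation x x·k·y≡u | index-of-factorisation z z·k̄·w≡u
  ... | p , u[p]≡k , p≡|x| | q , u[q]≡k̄ , q≡|z| =
    subst₂ (λ s t → suc s + t ≤ suc (toℕ k)) p≡|x|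
      (trans (cong (length u ∸_) q≡|z|) (length-suffix z z·k̄·w≡u))
      (adm p q k u[p]≡k u[q]≡k̄)

  factorisations⇒admissible : (u : Word n) → StrictlyIncreasing u →
                              AdmissibleFactorisations u → AdmissibleColumn u
  factorisations⇒admissible u inc adm = inc , bound
    where
    bound : (p q : Fin (length u)) (k : Fin n) → lookup u p ≡ pos k → lookup u q ≡ neg k →
            suc (toℕ p) + (length u ∸ toℕ q) ≤ suc (toℕ k)
    bound p q k u[p]≡k u[q]≡k̄ with factorisation-at u p | factorisation-at u q
    ... | x , y , x·a·y≡u , |x|≡p | z , w , z·b·w≡u , |z|≡q =
      subst₂ (λ s t → suc s + t ≤ suc (toℕ k)) |x|≡p
        (trans (sym (length-suffix z z·k̄·w≡u)) (cong (length u ∸_) |z|≡q))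
        (adm k x y z w (subst (λ c → x ++ c ∷ y ≡ u) u[p]≡k x·a·y≡u) z·k̄·w≡u)
      where
      z·k̄·w≡u : z ++ neg k ∷ w ≡ u
      z·k̄·w≡u = subst (λ c → z ++ c ∷ w ≡ u) u[q]≡k̄ z·b·w≡u

  AdmissibleFactorisations-⋆ : (u : Word n) → AdmissibleFactorisations u → AdmissibleFactorisations (u ⋆)
  AdmissibleFactorisations-⋆ u adm k x y z w x·k·y≡u⋆ z·k̄·w≡u⋆ =
    subst₂ (λ s t → suc s + suc t ≤ suc (toℕ k)) (length-⋆ x) (length-⋆ w)
      (subst (_≤ suc (toℕ k)) (+-comm (suc (length (w ⋆))) (suc (length (x ⋆))))
        (adm k (w ⋆) (z ⋆) (y ⋆) (x ⋆) (⋆-split z·k̄·w≡u⋆) (⋆-split x·k·y≡u⋆)))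

  AdmissibleColumn-⋆ : (u : Word n) → AdmissibleColumn u → AdmissibleColumn (u ⋆)
  AdmissibleColumn-⋆ u adm =
    factorisations⇒admissible (u ⋆) (StrictlyIncreasing-⋆ (proj₁ adm))
      (AdmissibleFactorisations-⋆ u (admissible⇒factorisations u adm))

  AdmissibleColumn-⋆⁻ : (u : Word n) → AdmissibleColumn (u ⋆) → AdmissibleColumn u
  AdmissibleColumn-⋆⁻ u adm = subst AdmissibleColumn (⋆-involutive u) (AdmissibleColumn-⋆ (u ⋆) adm)

  ProperFactorsAdmissible-⋆ : (u : Word n) → ProperFactorsAdmissible u → ProperFactorsAdmissible (u ⋆)
  ProperFactorsAdmissible-⋆ u adm x f y x·f·y≡u⋆ |f|<|u⋆| =
    AdmissibleColumn-⋆⁻ f (adm (y ⋆) (f ⋆) (x ⋆) y⋆·f⋆·x⋆≡u (subst₂ _<_ (sym (length-⋆ f)) (length-⋆ u) |f|<|u⋆|))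
    where
    y⋆·f⋆·x⋆≡u : (y ⋆) ++ (f ⋆) ++ (x ⋆) ≡ u
    y⋆·f⋆·x⋆≡u = trans (sym (⋆-++-++ x f y)) (trans (cong _⋆ x·f·y≡u⋆) (⋆-involutive u))

  countLe-map-bar : (m : ℕ) (u : Word n) → countLe m (map bar u) ≡ countLe m u
  countLe-map-bar m []      = refl
  countLe-map-bar m (a ∷ u) rewrite absv-bar a with does (absv a ≤? m)
  ... | true  = cong suc (countLe-map-bar m u)
  ... | false = countLe-map-bar m u

  countLe-⋆ : (m : ℕ) (u : Word n) → countLe m (u ⋆) ≡ countLe m u
  countLe-⋆ m u =
    trans (↭-length (filter-↭ (λ a → absv a ≤? m) (↭-reverse (map bar u)))) (countLe-map-bar m u)

  K5Cond-⋆ : (u : Word n) (z : Fin n) → K5Cond u z → K5Cond (u ⋆) z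
  K5Cond-⋆ u z (z∈u , z̄∈u , many) =
    ∈-⋆ z̄∈u , ∈-⋆ z∈u , subst (_> suc (toℕ z)) (sym (countLe-⋆ (suc (toℕ z)) u)) many

  K5Cond-⋆⁻ : (u : Word n) (z : Fin n) → K5Cond (u ⋆) z → K5Cond u z
  K5Cond-⋆⁻ u z c = subst (λ v → K5Cond v z) (⋆-involutive u) (K5Cond-⋆ (u ⋆) z c)

  LeastK5-⋆ : (u : Word n) (z : Fin n) → LeastK5 u z → LeastK5 (u ⋆) z
  LeastK5-⋆ u z (c , least) = K5Cond-⋆ u z c , λ z' z'<z c' → least z' z'<z (K5Cond-⋆⁻ u z' c')

  removeZ-ʳ++ : (z : Fin n) (xs ys : Word n) → removeZ z (xs ʳ++ ys) ≡ removeZ z xs ʳ++ removeZ z ys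
  removeZ-ʳ++ z []           ys = refl
  removeZ-ʳ++ z (pos i ∷ xs) ys with toℕ i ≟ toℕ z | removeZ-ʳ++ z xs (pos i ∷ ys)
  ... | yes _ | ih = ih
  ... | no  _ | ih = ih
  removeZ-ʳ++ z (neg i ∷ xs) ys with toℕ i ≟ toℕ z | removeZ-ʳ++ z xs (neg i ∷ ys)
  ... | yes _ | ih = ih
  ... | no  _ | ih = ih

  removeZ-map-bar : (z : Fin n) (u : Word n) → removeZ z (map bar u) ≡ map bar (removeZ z u)
  removeZ-map-bar z []          = refl
  removeZ-map-bar z (pos i ∷ u) with toℕ i ≟ toℕ z
  ... | yes _ = removeZ-map-bar z u
  ... | no  _ = cong (neg i ∷_) (removeZ-map-bar z u)
  removeZ-map-bar z (neg i ∷ u) with toℕ i ≟ toℕ z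
  ... | yes _ = removeZ-map-bar z u
  ... | no  _ = cong (pos i ∷_) (removeZ-map-bar z u)

  removeZ-⋆ : (z : Fin n) (u : Word n) → removeZ z (u ⋆) ≡ (removeZ z u) ⋆
  removeZ-⋆ z u = trans (removeZ-ʳ++ z (map bar u) []) (cong reverse (removeZ-map-bar z u))

  ∼-cong : (a b : Word n) {p q : Word n} → p ∼ q → (a ++ p ++ b) ∼ (a ++ q ++ b)
  ∼-cong a b (step {x} {l} {r} {y} e) = subst₂ _∼_ (reassoc l) (reassoc r) (step {x = a ++ x} {y = y ++ b} e)
    where
    open ≡-Reasoning
    reassoc : (m : Word n) → (a ++ x) ++ m ++ y ++ b ≡ a ++ (x ++ m ++ y) ++ b
    reassoc m = begin
      (a ++ x) ++ m ++ y ++ b   ≡⟨ ++-assoc a x (m ++ y ++ b) ⟩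
      a ++ x ++ m ++ y ++ b     ≡⟨ cong (λ t → a ++ x ++ t) (++-assoc m y b) ⟨
      a ++ x ++ (m ++ y) ++ b   ≡⟨ cong (a ++_) (++-assoc x (m ++ y) b) ⟨
      a ++ (x ++ m ++ y) ++ b   ∎
  ∼-cong a b refl∼          = refl∼
  ∼-cong a b (sym∼ p∼q)     = sym∼ (∼-cong a b p∼q)
  ∼-cong a b (trans∼ p∼q q∼r) = trans∼ (∼-cong a b p∼q) (∼-cong a b q∼r)

  Elem⇒∼ : {l r : Word n} → Elem l r → l ∼ r
  Elem⇒∼ {l} {r} e = subst₂ _∼_ (++-identityʳ l) (++-identityʳ r) (step {x = []} {y = []} e)

  Elem-⋆ : {l r : Word n} → Elem l r → (l ⋆) ∼ (r ⋆)
  Elem-⋆ (K1 γ<α α≤β ¬bp) =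
    sym∼ (Elem⇒∼ (K2 (bar-reverses-≤ α≤β) (bar-reverses-< γ<α) (¬BarPair-bar ¬bp)))
  Elem-⋆ (K2 γ≤α α<β ¬bp) =
    sym∼ (Elem⇒∼ (K1 (bar-reverses-< α<β) (bar-reverses-≤ γ≤α) (¬BarPair-bar ¬bp)))
  Elem-⋆ (K3 j≡i+1 y<β β<ȳ) = sym∼ (Elem⇒∼ (K4 j≡i+1 (bar-reverses-< β<ȳ) (bar-reverses-< y<β)))
  Elem-⋆ (K4 j≡i+1 y<β β<ȳ) = sym∼ (Elem⇒∼ (K3 j≡i+1 (bar-reverses-< β<ȳ) (bar-reverses-< y<β)))
  Elem-⋆ (K5 {u} {z} inc ¬adm proper least) =
    subst ((u ⋆) ∼_) (removeZ-⋆ z u)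
      (Elem⇒∼ (K5 (StrictlyIncreasing-⋆ inc) (λ adm → ¬adm (AdmissibleColumn-⋆⁻ u adm))
                  (ProperFactorsAdmissible-⋆ u proper) (LeastK5-⋆ u z least)))

  ∼-⋆ : {v w : Word n} → v ∼ w → (v ⋆) ∼ (w ⋆)
  ∼-⋆ (step {x} {l} {r} {y} e) =
    subst₂ _∼_ (sym (⋆-++-++ x l y)) (sym (⋆-++-++ x r y)) (∼-cong (y ⋆) (x ⋆) (Elem-⋆ e))
  ∼-⋆ refl∼             = refl∼
  ∼-⋆ (sym∼ v∼w)        = sym∼ (∼-⋆ v∼w)
  ∼-⋆ (trans∼ u∼v v∼w)  = trans∼ (∼-⋆ u∼v) (∼-⋆ v∼w)

theorem5p8 : (n : ℕ) (v w : Word n) → (v ∼ w) ⇔ ((v ⋆) ∼ (w ⋆))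
theorem5p8 n v w = mk⇔ ∼-⋆ (λ v⋆∼w⋆ → subst₂ _∼_ (⋆-involutive v) (⋆-involutive w) (∼-⋆ v⋆∼w⋆))
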